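{- If a directed binary Boolean VCSP instance $\mathcal{C}$ has a triangle-free constraint graph, then $\mathcal{C}$ is oriented.
   Context: A binary Boolean VCSP instance $\mathcal{C}$ on $[n]$ is a collection of nonzero integer weights $c_S$, $S\subseteq[n]$, $|S|\le2$ ($c_i=c_{\{i\}}$, $c_{ij}=c_{\{i,j\}}$, absent weights $0$). Constraint graph: edge $\{i,j\}$ iff $c_{ij}\in\mathcal{C}$; $N(i)$ its neighbourhood. Effective unary $\hat c_i(x,S)=c_i+\sum_{j\in N(i)\setminus S}x_jc_{ij}$ for $x\in\{0,1\}^n$. Arcs $A(\mathcal{C})$: for each edge $\{i,j\}$, (1) $i\leftrightarrow j\in A(\mathcal{C})$ if some $x$ has $|c_{ij}|>\max\{|\hat c_i(x,\{i,j\})|,|\hat c_j(x,\{i,j\})|\}$ with $\mathrm{sgn}(c_{ij})$ different from both $\mathrm{sgn}(\hat c_i(x,\{i,j\}))$ and $\mathrm{sgn}(\hat c_j(x,\{i,j\}))$; (2) otherwise (a) $i\to j\in A(\mathcal{C})$ if some $y$ has $|c_{ij}|>|\hat c_j(y,\{i,j\})|$ and $\mathrm{sgn}(c_{ij})\ne\mathrm{sgn}(\hat c_j(y,\{i,j\}))$, and (b) $j\to i\in A(\mathcal{C})$ if some $z$ has $|c_{ij}|>|\hat c_i(z,\{i,j\})|$ and $\mathrm{sgn}(c_{ij})\ne\mathrm{sgn}(\hat c_i(z,\{i,j\}))$. $\mathcal{C}$ is directed if $A(\mathcal{C})$ has no bidirected arc, and oriented if it is directed and has at most one arc for each pair $i\ne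 j$. -}

module Defs where

open import Data.Nat using (ℕ; zero; suc)
open import Data.Fin using (Fin; zero; suc)
open import Data.Integer using (ℤ; +_; -[1+_]; _+_; _*_; ∣_∣; 0ℤ; 1ℤ; -1ℤ)
open import Data.Bool using (Bool; true; false)
open import Data.Product using (_×_; ∃)
open import Relation.Binary.PropositionalEquality using (_≡_; _≢_)
open import Relation.Nullary using (¬_; yes; no)
open import Data.Fin using (_≟_)
import Data.Integer as ℤ
import Data.Nat as ℕ

-- A binary Boolean VCSP instance on [n] = Fin n.
-- unary i      = c_i      (0 if absent)
-- binary i j   = c_{ij}   (0 if absent), symmetric since c_{ij} = c_{{i,j}};
-- diagonal entries are irrelevant (never used: edges require i ≢ j).
record VCSP (n : ℕ) : Set where
  field
    unary    : Fin n → ℤ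
    binary   : Fin n → Fin n → ℤ
    binary-sym : ∀ i j → binary i j ≡ binary j i
open VCSP public

Σ[<_]_ : (n : ℕ) → (Fin n → ℤ) → ℤ
Σ[< zero ] f = 0ℤ
Σ[< suc n ] f = f zero + Σ[< n ] (λ k → f (suc k))

sgn : ℤ → ℤ
sgn (+ zero)  = 0ℤ
sgn (+ suc _) = 1ℤ
sgn -[1+ _ ]  = -1ℤ

bit : Bool → ℤ
bit true  = 1ℤ
bit false = 0ℤ

module _ {n : ℕ} (C : VCSP n) where

  Edge : Fin n → Fin n → Set
  Edge i j = (i ≢ j) × (binary C i j ≢ 0ℤ)

  effUnary : Fin n → (Fin n → Bool) → Fin n → Fin n → ℤ
  effUnary i x a b = unary C i + Σ[< n ] term
    where
    term : Fin n → ℤ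
    term j with j ≟ i | j ≟ a | j ≟ b | binary C i j ℤ.≟ 0ℤ
    ... | no _ | no _ | no _ | no _ = bit (x j) * binary C i j
    ... | _    | _    | _    | _    = 0ℤ

  BiArc : Fin n → Fin n → Set
  BiArc i j = Edge i j × ∃ λ (x : Fin n → Bool) →
      (∣ effUnary i x i j ∣ ℕ.< ∣ binary C i j ∣)
    × (∣ effUnary j x i j ∣ ℕ.< ∣ binary C i j ∣)
    × (sgn (binary C i j) ≢ sgn (effUnary i x i j))
    × (sgn (binary C i j) ≢ sgn (effUnary j x i j))

  Arc : Fin n → Fin n → Set
  Arc i j = Edge i j × ¬ BiArc i j × ∃ λ (y : Fin n → Bool) →
      (∣ effUnary j y i j ∣ ℕ.< ∣ binary C i j ∣)
    × (sgn (binary C i j) ≢ sgn (effUnary j y i j))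

  Directed : Set
  Directed = ∀ i j → ¬ BiArc i j

  Oriented : Set
  Oriented = Directed × (∀ i j → i ≢ j → ¬ (Arc i j × Arc j i))

  TriangleFree : Set
  TriangleFree = ∀ i j k → ¬ (Edge i j × Edge j k × Edge i k)

-- Suppose i → j and j → i are both arcs, witnessed by y (for ĉ_j) and by z (for ĉ_i).
-- The effective unary ĉ_i(x, {i,j}) only reads x on N(i), and ĉ_j(x, {i,j}) only on N(j).
-- In a triangle-free graph no neighbour of i is a neighbour of j, so the assignment that
-- follows y on N(j) and z elsewhere witnesses both conditions at once, i.e. a bidirected
-- arc i ↔ j, which directedness forbids.
module Submission where

open import Defs
open import Data.Nat using (ℕ)
import Data.Nat as ℕ
open import Data.Fin using (Fin; zero; suc; _≟_)
open import Data.Integer using (ℤ; 0ℤ; ∣_∣; _+_)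
import Data.Integer as ℤ
open import Data.Bool using (Bool; if_then_else_)
open import Data.Product using (_×_; _,_)
open import Relation.Binary.PropositionalEquality using (_≡_; _≢_; refl; sym; ≢-sym; trans; cong; cong₂; subst; subst₂)
open import Relation.Nullary using (¬_; Dec; does; yes; no)
open import Relation.Nullary.Decidable using (¬?; _×-dec_; dec-true; dec-false)

Σ[<]-cong : ∀ m {f g : Fin m → ℤ} → (∀ k → f k ≡ g k) → Σ[< m ] f ≡ Σ[< m ] g
Σ[<]-cong ℕ.zero    f≗g = refl
Σ[<]-cong (ℕ.suc m) f≗g = cong₂ _+_ (f≗g zero) (Σ[<]-cong m (λ k → f≗g (suc k)))

Dominates : ℤ → ℤ → Set
Dominates c e = ∣ e ∣ ℕ.< ∣ c ∣ × sgn c ≢ sgn e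

module _ {n : ℕ} (C : VCSP n) where

  edge? : ∀ i j → Dec (Edge C i j)
  edge? i j = ¬? (i ≟ j) ×-dec ¬? (binary C i j ℤ.≟ 0ℤ)

  -- The summand of effUnary is local to a where-block of Defs and cannot be named, so the
  -- pointwise helpers get partial signatures; their metavariables are solved by checking
  -- sums-equal before the helpers' clauses.
  effUnary-comm : ∀ i x a b → effUnary C i x a b ≡ effUnary C i x b a
  effUnary-comm i x a b = sums-equal
    where
    summand-comm : ∀ k → _ ≡ _
    sums-equal : effUnary C i x a b ≡ effUnary C i x b a
    sums-equal = cong (unary C i +_) (Σ[<]-cong n summand-comm)
    summand-comm k with k ≟ i | k ≟ a | k ≟ b | binary C i k ℤ.≟ 0ℤ
    ... | yes _ | _     | _     | _     = refl
    ... | no _  | yes _ | yes _ | _     = refl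
    ... | no _  | yes _ | no _  | _     = refl
    ... | no _  | no _  | yes _ | _     = refl
    ... | no _  | no _  | no _  | yes _ = refl
    ... | no _  | no _  | no _  | no _  = refl

  effUnary-local : ∀ i {x x′} a b → (∀ k → Edge C i k → x k ≡ x′ k) →
                   effUnary C i x a b ≡ effUnary C i x′ a b
  effUnary-local i {x} {x′} a b x≗x′ = sums-equal
    where
    summand-local : ∀ k → _ ≡ _
    sums-equal : effUnary C i x a b ≡ effUnary C i x′ a b
    sums-equal = cong (unary C i +_) (Σ[<]-cong n summand-local)
    summand-local k with k ≟ i | k ≟ a | k ≟ b | binary C i k ℤ.≟ 0ℤ
    ... | yes _   | _     | _     | _        = refl
    ... | no _    | yes _ | _     | _        = refl
    ... | no _    | no _  | yes _ | _        = refl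
    ... | no _    | no _  | no _  | yes _    = refl
    ... | no k≢i  | no _  | no _  | no cᵢₖ≢0 =
      cong (λ v → bit v ℤ.* binary C i k) (x≗x′ k (≢-sym k≢i , cᵢₖ≢0))

  splice : Fin n → (Fin n → Bool) → (Fin n → Bool) → Fin n → Bool
  splice j y z k = if does (edge? j k) then y k else z k

  splice-neighbour : ∀ {j k} y z → Edge C j k → splice j y z k ≡ y k
  splice-neighbour {j} {k} y z ejk rewrite dec-true (edge? j k) ejk = refl

  splice-nonneighbour : ∀ {j k} y z → ¬ Edge C j k → splice j y z k ≡ z k
  splice-nonneighbour {j} {k} y z ¬ejk rewrite dec-false (edge? j k) ¬ejk = refl

  dominated⇒BiArc : ∀ {i j} x → Edge C i j →
                    Dominates (binary C i j) (effUnary C i x i j) →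
                    Dominates (binary C i j) (effUnary C j x i j) → BiArc C i j
  dominated⇒BiArc x eij (|ĉᵢ|< , sgn≢ᵢ) (|ĉⱼ|< , sgn≢ⱼ) = eij , x , |ĉᵢ|< , |ĉⱼ|< , sgn≢ᵢ , sgn≢ⱼ

  two-way-arc⇒BiArc : ∀ {i j} → TriangleFree C → Arc C i j → Arc C j i → BiArc C i j
  two-way-arc⇒BiArc {i} {j} triangleFree (eij , _ , y , dom-ĉⱼ) (_ , _ , z , dom-ĉᵢ) =
    dominated⇒BiArc x eij (subst₂ Dominates (binary-sym C j i) ĉᵢ-eq dom-ĉᵢ)
                          (subst (Dominates (binary C i j)) ĉⱼ-eq dom-ĉⱼ)
    where
    x : Fin n → Bool
    x = splice j y z

    ĉᵢ-eq : effUnary C i z j i ≡ effUnary C i x i j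
    ĉᵢ-eq = trans (effUnary-comm i z j i) (effUnary-local i i j z≗x)
      where
      z≗x : ∀ k → Edge C i k → z k ≡ x k
      z≗x k eik = sym (splice-nonneighbour y z (λ ejk → triangleFree i j k (eij , ejk , eik)))

    ĉⱼ-eq : effUnary C j y i j ≡ effUnary C j x i j
    ĉⱼ-eq = effUnary-local j i j (λ k ejk → sym (splice-neighbour y z ejk))

theoremA3 : (n : ℕ) (C : VCSP n) → Directed C → TriangleFree C → Oriented C
theoremA3 n C directed triangleFree =
  directed , λ i j _ (arc-ij , arc-ji) → directed i j (two-way-arc⇒BiArc C triangleFree arc-ij arc-ji)
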